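{- Let $\mathcal{R}'=\{\beta,\mu,\mu',\rho,\varepsilon\}$. The set $\mathcal{WN}_{\mathcal{R}'}\cap\mathcal{T}_t$ is saturated.
   Context: $\lambda\mu$-terms: $\mathcal{T} ::= x \mid \lambda x.\mathcal{T} \mid (\mathcal{T})\mathcal{T} \mid [\alpha]\mathcal{T} \mid \mu\alpha.\mathcal{T}$, up to renaming of bound variables; substitutions avoid capture. Types $A ::= X \mid \bot \mid A\to B$; typing judgments $\Gamma\vdash M:A;\Theta$ by: $\Gamma,x:A\vdash x:A;\Theta$; from $\Gamma,x:A\vdash M:B;\Theta$ infer $\Gamma\vdash\lambda x.M:A\to B;\Theta$; from $\Gamma\vdash M:A\to B;\Theta$, $\Gamma\vdash N:A;\Theta$ infer $\Gamma\vdash(M)N:B;\Theta$; from $\Gamma\vdash M:A;\alpha:A,\Theta$ infer $\Gamma\vdash[\alpha]M:\bot;\alpha:A,\Theta$; from $\Gamma\vdash M:\bot;\alpha:A,\Theta$ infer $\Gamma\vdash\mu\alpha.M:A;\Theta$. $\mathcal{T}_t$ = typable terms. $(M)P_1\dots P_k=(\dots((M)P_1)\dots)P_k$; $\mathcal{L}^{<\omega}$ = finite sequences from $\mathcal{L}$. $M[\alpha:=\beta]$ renames; $M[\alpha:=_rN]$ (resp. $M[\alpha:=_lN]$) replaces inductively each $[\alpha]P$ by $[\alpha](P')N$ (resp. $[\alpha](N)P'$); $M[\alpha:=_rN_1\dots N_n]=M[\alpha:=_rN_1]\dots[\alpha:=_rN_n]$; $M_\alpha$ replaces inductively each $[\alpha]P$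 by $P$. Rules: $\beta$: $(\lambda x.M)N\to M[x:=N]$; $\mu$: $(\mu\alpha.M)N\to\mu\alpha.M[\alpha:=_rN]$; $\mu'$: $(N)\mu\alpha.M\to\mu\alpha.M[\alpha:=_lN]$; $\rho$: $[\beta]\mu\alpha.M\to M[\alpha:=\beta]$; $\varepsilon$: $\mu\alpha.\mu\beta.M\to\mu\alpha.M_\beta$. $\mathcal{WN}_{\mathcal{R}'}$: terms reducing (one redex contracted per step, anywhere) to a term with no $\mathcal{R}'$-redex. Saturated set: $\mathcal{B}\subseteq\mathcal{T}_t$ with (C1) $M\in\mathcal{B}\Rightarrow\lambda x.M\in\mathcal{B}$; (C2) $M\in\mathcal{B}$, $\mu\alpha.M\in\mathcal{T}_t\Rightarrow\mu\alpha.M\in\mathcal{B}$; (C3) $M\in\mathcal{B}$, $[\alpha]M\in\mathcal{T}_t\Rightarrow[\alpha]M\in\mathcal{B}$; (C4) $n\ge0$, $N_1,\dots,N_n\in\mathcal{B}$, $(x)N_1\dots N_n\in\mathcal{T}_t\Rightarrow(x)N_1\dots N_n\in\mathcal{B}$; (C5) $M,N\in\mathcal{T}_t$, $\bar P\in\mathcal{T}_t^{<\omega}$, $N\in\mathcal{B}$, $(\lambda x.M)N\bar P\in\mathcal{T}_t$, $(M[x:=N])\bar P\in\mathcal{B}\Rightarrow(\lambda x.M)N\bar P\in\mathcal{B}$; (C6) $M\in\mathcal{T}_t$, $\bar N\in\mathcal{B}^{<\omega}$, $(\mu\alpha.M)\bar N\in\mathcal{T}_t$, $\mu\alpha.M[\alpha:=_r\bar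 N]\in\mathcal{B}\Rightarrow(\mu\alpha.M)\bar N\in\mathcal{B}$. -}

module Defs where

open import Data.Nat using (ℕ; zero; suc; pred; _≡ᵇ_; _<ᵇ_)
open import Data.Bool using (if_then_else_)
open import Data.List using (List; []; _∷_; foldl)
open import Data.List.Relation.Unary.All using (All)
open import Data.Maybe using (Maybe; just; nothing)
open import Data.Product using (Σ; ∃; _×_; _,_)
open import Relation.Nullary using (¬_)
open import Relation.Binary.PropositionalEquality using (_≡_)
open import Relation.Binary.Construct.Closure.ReflexiveTransitive using (Star)

-- λμ-terms, up to renaming of bound variables: de Bruijn indices.
-- Two separate index spaces: term variables (bound by lam) and
-- names / μ-variables (bound by mu).
--   var x      = x
--   lam M      = λx.M        (x = index 0 in M)
--   app M N    = (M)N
--   name α M   = [α]M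
--   mu M       = μα.M        (α = name index 0 in M)

data Tm : Set where
  var  : ℕ → Tm
  lam  : Tm → Tm
  app  : Tm → Tm → Tm
  name : ℕ → Tm → Tm
  mu   : Tm → Tm

apps : Tm → List Tm → Tm
apps = foldl app

ext : (ℕ → ℕ) → ℕ → ℕ
ext ρ zero    = zero
ext ρ (suc k) = suc (ρ k)

renT : (ℕ → ℕ) → Tm → Tm
renT ρ (var x)    = var (ρ x)
renT ρ (lam M)    = lam (renT (ext ρ) M)
renT ρ (app M N)  = app (renT ρ M) (renT ρ N)
renT ρ (name α M) = name α (renT ρ M)
renT ρ (mu M)     = mu (renT ρ M)

renN : (ℕ → ℕ) → Tm → Tm
renN ρ (var x)    = var x
renN ρ (lam M)    = lam (renN ρ M)
renN ρ (app M N)  = app (renN ρ M) (renN ρ N)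
renN ρ (name α M) = name (ρ α) (renN ρ M)
renN ρ (mu M)     = mu (renN (ext ρ) M)

extsT : (ℕ → Tm) → ℕ → Tm
extsT σ zero    = var zero
extsT σ (suc k) = renT suc (σ k)

subT : (ℕ → Tm) → Tm → Tm
subT σ (var x)    = σ x
subT σ (lam M)    = lam (subT (extsT σ) M)
subT σ (app M N)  = app (subT σ M) (subT σ N)
subT σ (name α M) = name α (subT σ M)
subT σ (mu M)     = mu (subT (λ k → renN suc (σ k)) M)

single : Tm → ℕ → Tm
single N zero    = N
single N (suc k) = var k

singleN : ℕ → ℕ → ℕ
singleN β zero    = β
singleN β (suc k) = k

-- M[α:=_r N] : every [α]P becomes [α](P')N  (α = name index i)
structR : ℕ → Tm → Tm → Tm
structR i N (var x)    = var x
structR i N (lam M)    = lam (structR i (renT suc N) M)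
structR i N (app M P)  = app (structR i N M) (structR i N P)
structR i N (name j P) =
  if j ≡ᵇ i then name j (app (structR i N P) N) else name j (structR i N P)
structR i N (mu M)     = mu (structR (suc i) (renN suc N) M)

-- M[α:=_l N] : every [α]P becomes [α](N)P'
structL : ℕ → Tm → Tm → Tm
structL i N (var x)    = var x
structL i N (lam M)    = lam (structL i (renT suc N) M)
structL i N (app M P)  = app (structL i N M) (structL i N P)
structL i N (name j P) =
  if j ≡ᵇ i then name j (app N (structL i N P)) else name j (structL i N P)
structL i N (mu M)     = mu (structL (suc i) (renN suc N) M)

-- index of name j after deleting the binder of name i (j ≠ i)
punch : ℕ → ℕ → ℕ
punch i j = if j <ᵇ i then j else pred j

-- M_α : every [α]P becomes P (and the binder of α is removed)
erase : ℕ → Tm → Tm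
erase i (var x)    = var x
erase i (lam M)    = lam (erase i M)
erase i (app M P)  = app (erase i M) (erase i P)
erase i (name j P) = if j ≡ᵇ i then erase i P else name (punch i j) (erase i P)
erase i (mu M)     = mu (erase (suc i) M)

-- body of μα.M under the outer μ-binder, after M[α:=_r N₁ … Nₙ]
-- (M is the de Bruijn body of μα.M, α = name index 0)
muStructRs : Tm → List Tm → Tm
muStructRs M Ns = foldl (λ M' N → structR 0 (renN suc N) M') M Ns

-- the de Bruijn body of λx.M (resp. μα.M) for a named variable x
-- (resp. name α) that is free in M: x ↦ 0, every other y ↦ y+1
bindAt : ℕ → ℕ → ℕ
bindAt x y = if y ≡ᵇ x then zero else suc y

data Ty : Set where
  atom : ℕ → Ty
  bot  : Ty
  _⇒_  : Ty → Ty → Ty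

infixr 7 _⇒_

_‼_ : List Ty → ℕ → Maybe Ty
[]      ‼ k       = nothing
(A ∷ Γ) ‼ zero    = just A
(A ∷ Γ) ‼ suc k   = Γ ‼ k

-- Γ ⊢ M : A ; Θ   (Γ types term variables, Θ types names)
data _⊢_∶_∣_ : List Ty → Tm → Ty → List Ty → Set where
  ty-var  : ∀ {Γ Θ x A} → Γ ‼ x ≡ just A → Γ ⊢ var x ∶ A ∣ Θ
  ty-lam  : ∀ {Γ Θ M A B} → (A ∷ Γ) ⊢ M ∶ B ∣ Θ → Γ ⊢ lam M ∶ A ⇒ B ∣ Θ
  ty-app  : ∀ {Γ Θ M N A B} → Γ ⊢ M ∶ A ⇒ B ∣ Θ → Γ ⊢ N ∶ A ∣ Θ →
            Γ ⊢ app M N ∶ B ∣ Θ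
  ty-name : ∀ {Γ Θ α M A} → Θ ‼ α ≡ just A → Γ ⊢ M ∶ A ∣ Θ →
            Γ ⊢ name α M ∶ bot ∣ Θ
  ty-mu   : ∀ {Γ Θ M A} → Γ ⊢ M ∶ bot ∣ (A ∷ Θ) → Γ ⊢ mu M ∶ A ∣ Θ

Typable : Tm → Set
Typable M = Σ (List Ty) λ Γ → Σ (List Ty) λ Θ → Σ Ty λ A → Γ ⊢ M ∶ A ∣ Θ

infix 4 _⟶_
data _⟶_ : Tm → Tm → Set where
  r-β    : ∀ {M N} → app (lam M) N ⟶ subT (single N) M
  r-μ    : ∀ {M N} → app (mu M) N ⟶ mu (structR 0 (renN suc N) M)
  r-μ'   : ∀ {M N} → app N (mu M) ⟶ mu (structL 0 (renN suc N) M)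
  r-ρ    : ∀ {β M} → name β (mu M) ⟶ renN (singleN β) M
  r-ε    : ∀ {M} → mu (mu M) ⟶ mu (erase 0 M)
  c-lam  : ∀ {M M'} → M ⟶ M' → lam M ⟶ lam M'
  c-appl : ∀ {M M' N} → M ⟶ M' → app M N ⟶ app M' N
  c-appr : ∀ {M N N'} → N ⟶ N' → app M N ⟶ app M N'
  c-name : ∀ {α M M'} → M ⟶ M' → name α M ⟶ name α M'
  c-mu   : ∀ {M M'} → M ⟶ M' → mu M ⟶ mu M'

infix 4 _⟶*_
_⟶*_ : Tm → Tm → Set
_⟶*_ = Star _⟶_

Normal : Tm → Set
Normal M = ∀ N → ¬ (M ⟶ N)

WN : Tm → Set
WN M = ∃ λ N → (M ⟶* N) × Normal N

record Saturated (B : Tm → Set) : Set where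
  field
    sub : ∀ M → B M → Typable M
    C1  : ∀ x M → B M → B (lam (renT (bindAt x) M))
    C2  : ∀ α M → B M → Typable (mu (renN (bindAt α) M)) →
          B (mu (renN (bindAt α) M))
    C3  : ∀ α M → B M → Typable (name α M) → B (name α M)
    C4  : ∀ x (Ns : List Tm) → All B Ns → Typable (apps (var x) Ns) →
          B (apps (var x) Ns)
    C5  : ∀ M N (Ps : List Tm) → Typable M → Typable N → All Typable Ps →
          B N → Typable (apps (app (lam M) N) Ps) →
          B (apps (subT (single N) M) Ps) →
          B (apps (app (lam M) N) Ps)
    C6  : ∀ M (Ns : List Tm) → Typable M → All B Ns →
          Typable (apps (mu M) Ns) → B (mu (muStructRs M Ns)) →
          B (apps (mu M) Ns)

-- Closure under C5 and C6 holds because the left-hand side reduces to the right-hand side,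
-- and under C1–C3 because a normal form stays normal under λ, and under μ or [α] after at
-- most one ε- or ρ-step.  The substance is C4: after normalising the arguments, (x)N₁…Nₙ is
-- normalised from left to right.  The head is always either a neutral normal form or a normal
-- μα.K in which every [α]P has P neutral.  Applying the next normal argument N to a neutral
-- head gives a neutral normal form or a μ′-redex whose contractum is of the second kind;
-- applying it to μα.K gives a μ-redex whose contractum μα.K[α:=_r N] only needs the new
-- [α](P)N fixed, by μ′ and ρ when N is itself a μ-abstraction, and is again of the second kind.

module Submission where

open import Defs
open import Data.Nat using (ℕ; zero; suc; _≡ᵇ_; _<ᵇ_)
open import Data.Nat.Properties using (≡ᵇ⇒≡; ≡⇒≡ᵇ; suc-injective)
open import Data.Bool using (true; false; T)
open import Data.List using (List; []; _∷_)
open import Data.List.Relation.Unary.All as All using (All; []; _∷_)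
open import Data.Maybe using (just; fromMaybe)
open import Data.Maybe.Properties using (just-injective)
open import Data.Product using (Σ; _×_; _,_; proj₁; proj₂)
open import Data.Empty using (⊥; ⊥-elim)
open import Data.Unit using (⊤; tt)
open import Function using (_∘_)
open import Function.Definitions using (Injective)
open import Relation.Nullary using (¬_)
open import Relation.Binary.PropositionalEquality
open import Relation.Binary.Construct.Closure.ReflexiveTransitive using (ε; _◅_; _◅◅_; gmap)

≡ᵇ-true⇒≡ : ∀ j i → (j ≡ᵇ i) ≡ true → j ≡ i
≡ᵇ-true⇒≡ j i e = ≡ᵇ⇒≡ j i (subst T (sym e) tt)

≡ᵇ-false⇒≢ : ∀ j i → (j ≡ᵇ i) ≡ false → ¬ (j ≡ i)
≡ᵇ-false⇒≢ j i e j≡i = subst T e (≡⇒≡ᵇ j i j≡i)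

≡ᵇ-injective : ∀ {g} → Injective _≡_ _≡_ g → ∀ j i → (g j ≡ᵇ g i) ≡ (j ≡ᵇ i)
≡ᵇ-injective {g} inj j i with j ≡ᵇ i in e | g j ≡ᵇ g i in e'
... | true  | true  = refl
... | false | false = refl
... | true  | false = ⊥-elim (≡ᵇ-false⇒≢ (g j) (g i) e' (cong g (≡ᵇ-true⇒≡ j i e)))
... | false | true  = ⊥-elim (≡ᵇ-false⇒≢ j i e (inj (≡ᵇ-true⇒≡ (g j) (g i) e')))

ext-injective : ∀ {g} → Injective _≡_ _≡_ g → Injective _≡_ _≡_ (ext g)
ext-injective inj {zero}  {zero}  _ = refl
ext-injective inj {suc a} {suc b} p = cong suc (inj (suc-injective p))

bindAt-injective : ∀ x → Injective _≡_ _≡_ (bindAt x)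
bindAt-injective x {a} {b} p with a ≡ᵇ x in ea | b ≡ᵇ x in eb
... | true  | true  = trans (≡ᵇ-true⇒≡ a x ea) (sym (≡ᵇ-true⇒≡ b x eb))
... | false | false = suc-injective p

ext-cong : ∀ {f g} → f ≗ g → ext f ≗ ext g
ext-cong p zero    = refl
ext-cong p (suc k) = cong suc (p k)

ext-∘ : ∀ f g → ext f ∘ ext g ≗ ext (f ∘ g)
ext-∘ f g zero    = refl
ext-∘ f g (suc k) = refl

punch-suc : ∀ i j → ¬ (j ≡ i) → punch (suc i) (suc j) ≡ suc (punch i j)
punch-suc zero    zero    j≢i = ⊥-elim (j≢i refl)
punch-suc (suc i) zero    j≢i = refl
punch-suc i       (suc j) j≢i with suc j <ᵇ i
... | true  = refl
... | false = refl

-- Renaming and substitution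

renT-cong : ∀ {f g} → f ≗ g → ∀ M → renT f M ≡ renT g M
renT-cong p (var x)    = cong var (p x)
renT-cong p (lam M)    = cong lam (renT-cong (ext-cong p) M)
renT-cong p (app M N)  = cong₂ app (renT-cong p M) (renT-cong p N)
renT-cong p (name α M) = cong (name α) (renT-cong p M)
renT-cong p (mu M)     = cong mu (renT-cong p M)

renN-cong : ∀ {f g} → f ≗ g → ∀ M → renN f M ≡ renN g M
renN-cong p (var x)    = refl
renN-cong p (lam M)    = cong lam (renN-cong p M)
renN-cong p (app M N)  = cong₂ app (renN-cong p M) (renN-cong p N)
renN-cong p (name α M) = cong₂ name (p α) (renN-cong p M)
renN-cong p (mu M)     = cong mu (renN-cong (ext-cong p) M)

renT-∘ : ∀ f g M → renT f (renT g M) ≡ renT (f ∘ g) M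
renT-∘ f g (var x)    = refl
renT-∘ f g (lam M)    = cong lam (trans (renT-∘ (ext f) (ext g) M) (renT-cong (ext-∘ f g) M))
renT-∘ f g (app M N)  = cong₂ app (renT-∘ f g M) (renT-∘ f g N)
renT-∘ f g (name α M) = cong (name α) (renT-∘ f g M)
renT-∘ f g (mu M)     = cong mu (renT-∘ f g M)

renN-∘ : ∀ f g M → renN f (renN g M) ≡ renN (f ∘ g) M
renN-∘ f g (var x)    = refl
renN-∘ f g (lam M)    = cong lam (renN-∘ f g M)
renN-∘ f g (app M N)  = cong₂ app (renN-∘ f g M) (renN-∘ f g N)
renN-∘ f g (name α M) = cong (name (f (g α))) (renN-∘ f g M)
renN-∘ f g (mu M)     = cong mu (trans (renN-∘ (ext f) (ext g) M) (renN-cong (ext-∘ f g) M))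

renT-suc-comm : ∀ f N → renT (ext f) (renT suc N) ≡ renT suc (renT f N)
renT-suc-comm f N = trans (renT-∘ (ext f) suc N) (sym (renT-∘ suc f N))

renN-suc-comm : ∀ g N → renN (ext g) (renN suc N) ≡ renN suc (renN g N)
renN-suc-comm g N = trans (renN-∘ (ext g) suc N) (sym (renN-∘ suc g N))

renT-renN : ∀ f g M → renT f (renN g M) ≡ renN g (renT f M)
renT-renN f g (var x)    = refl
renT-renN f g (lam M)    = cong lam (renT-renN (ext f) g M)
renT-renN f g (app M N)  = cong₂ app (renT-renN f g M) (renT-renN f g N)
renT-renN f g (name α M) = cong (name (g α)) (renT-renN f g M)
renT-renN f g (mu M)     = cong mu (renT-renN f (ext g) M)

subT-cong : ∀ {σ τ} → σ ≗ τ → ∀ M → subT σ M ≡ subT τ M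
subT-cong p (var x)    = p x
subT-cong {σ} {τ} p (lam M) = cong lam (subT-cong extsT-cong M)
  where
  extsT-cong : extsT σ ≗ extsT τ
  extsT-cong zero    = refl
  extsT-cong (suc k) = cong (renT suc) (p k)
subT-cong p (app M N)  = cong₂ app (subT-cong p M) (subT-cong p N)
subT-cong p (name α M) = cong (name α) (subT-cong p M)
subT-cong p (mu M)     = cong mu (subT-cong (cong (renN suc) ∘ p) M)

subT-renT : ∀ σ f M → subT σ (renT f M) ≡ subT (σ ∘ f) M
subT-renT σ f (var x)    = refl
subT-renT σ f (lam M)    = cong lam (trans (subT-renT (extsT σ) (ext f) M) (subT-cong extsT-ext M))
  where
  extsT-ext : extsT σ ∘ ext f ≗ extsT (σ ∘ f)
  extsT-ext zero    = refl
  extsT-ext (suc k) = refl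
subT-renT σ f (app M N)  = cong₂ app (subT-renT σ f M) (subT-renT σ f N)
subT-renT σ f (name α M) = cong (name α) (subT-renT σ f M)
subT-renT σ f (mu M)     = cong mu (subT-renT (renN suc ∘ σ) f M)

renT-subT : ∀ f σ M → renT f (subT σ M) ≡ subT (renT f ∘ σ) M
renT-subT f σ (var x)    = refl
renT-subT f σ (lam M)    = cong lam (trans (renT-subT (ext f) (extsT σ) M) (subT-cong renT-extsT M))
  where
  renT-extsT : renT (ext f) ∘ extsT σ ≗ extsT (renT f ∘ σ)
  renT-extsT zero    = refl
  renT-extsT (suc k) = renT-suc-comm f (σ k)
renT-subT f σ (app M N)  = cong₂ app (renT-subT f σ M) (renT-subT f σ N)
renT-subT f σ (name α M) = cong (name α) (renT-subT f σ M)
renT-subT f σ (mu M)     =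
  cong mu (trans (renT-subT f (renN suc ∘ σ) M) (subT-cong (renT-renN f suc ∘ σ) M))

renN-subT : ∀ g σ M → renN g (subT σ M) ≡ subT (renN g ∘ σ) (renN g M)
renN-subT g σ (var x)    = refl
renN-subT g σ (lam M)    =
  cong lam (trans (renN-subT g (extsT σ) M) (subT-cong renN-extsT (renN g M)))
  where
  renN-extsT : renN g ∘ extsT σ ≗ extsT (renN g ∘ σ)
  renN-extsT zero    = refl
  renN-extsT (suc k) = sym (renT-renN suc g (σ k))
renN-subT g σ (app M N)  = cong₂ app (renN-subT g σ M) (renN-subT g σ N)
renN-subT g σ (name α M) = cong (name (g α)) (renN-subT g σ M)
renN-subT g σ (mu M)     = cong mu (trans (renN-subT (ext g) (renN suc ∘ σ) M)
  (subT-cong (renN-suc-comm g ∘ σ) (renN (ext g) M)))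

structR-renT : ∀ f i N M → renT f (structR i N M) ≡ structR i (renT f N) (renT f M)
structR-renT f i N (var x)    = refl
structR-renT f i N (lam M)    = cong lam (trans (structR-renT (ext f) i (renT suc N) M)
  (cong (λ N' → structR i N' (renT (ext f) M)) (renT-suc-comm f N)))
structR-renT f i N (app M P)  = cong₂ app (structR-renT f i N M) (structR-renT f i N P)
structR-renT f i N (name j P) with j ≡ᵇ i
... | true  = cong (name j) (cong₂ app (structR-renT f i N P) refl)
... | false = cong (name j) (structR-renT f i N P)
structR-renT f i N (mu M)     = cong mu (trans (structR-renT f (suc i) (renN suc N) M)
  (cong (λ N' → structR (suc i) N' (renT f M)) (renT-renN f suc N)))

structL-renT : ∀ f i N M → renT f (structL i N M) ≡ structL i (renT f N) (renT f M)
structL-renT f i N (var x)    = refl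
structL-renT f i N (lam M)    = cong lam (trans (structL-renT (ext f) i (renT suc N) M)
  (cong (λ N' → structL i N' (renT (ext f) M)) (renT-suc-comm f N)))
structL-renT f i N (app M P)  = cong₂ app (structL-renT f i N M) (structL-renT f i N P)
structL-renT f i N (name j P) with j ≡ᵇ i
... | true  = cong (name j) (cong₂ app refl (structL-renT f i N P))
... | false = cong (name j) (structL-renT f i N P)
structL-renT f i N (mu M)     = cong mu (trans (structL-renT f (suc i) (renN suc N) M)
  (cong (λ N' → structL (suc i) N' (renT f M)) (renT-renN f suc N)))

erase-renT : ∀ f i M → renT f (erase i M) ≡ erase i (renT f M)
erase-renT f i (var x)    = refl
erase-renT f i (lam M)    = cong lam (erase-renT (ext f) i M)
erase-renT f i (app M N)  = cong₂ app (erase-renT f i M) (erase-renT f i N)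
erase-renT f i (name j P) with j ≡ᵇ i
... | true  = erase-renT f i P
... | false = cong (name (punch i j)) (erase-renT f i P)
erase-renT f i (mu M)     = cong mu (erase-renT f (suc i) M)

structR-renN : ∀ g → Injective _≡_ _≡_ g → ∀ i N M →
               renN g (structR i N M) ≡ structR (g i) (renN g N) (renN g M)
structR-renN g inj i N (var x)    = refl
structR-renN g inj i N (lam M)    = cong lam (trans (structR-renN g inj i (renT suc N) M)
  (cong (λ N' → structR (g i) N' (renN g M)) (sym (renT-renN suc g N))))
structR-renN g inj i N (app M P)  =
  cong₂ app (structR-renN g inj i N M) (structR-renN g inj i N P)
structR-renN g inj i N (name j P) rewrite ≡ᵇ-injective inj j i with j ≡ᵇ i
... | true  = cong (name (g j)) (cong₂ app (structR-renN g inj i N P) refl)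
... | false = cong (name (g j)) (structR-renN g inj i N P)
structR-renN g inj i N (mu M)     =
  cong mu (trans (structR-renN (ext g) (ext-injective inj) (suc i) (renN suc N) M)
    (cong (λ N' → structR (suc (g i)) N' (renN (ext g) M)) (renN-suc-comm g N)))

structL-renN : ∀ g → Injective _≡_ _≡_ g → ∀ i N M →
               renN g (structL i N M) ≡ structL (g i) (renN g N) (renN g M)
structL-renN g inj i N (var x)    = refl
structL-renN g inj i N (lam M)    = cong lam (trans (structL-renN g inj i (renT suc N) M)
  (cong (λ N' → structL (g i) N' (renN g M)) (sym (renT-renN suc g N))))
structL-renN g inj i N (app M P)  =
  cong₂ app (structL-renN g inj i N M) (structL-renN g inj i N P)
structL-renN g inj i N (name j P) rewrite ≡ᵇ-injective inj j i with j ≡ᵇ i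
... | true  = cong (name (g j)) (cong₂ app refl (structL-renN g inj i N P))
... | false = cong (name (g j)) (structL-renN g inj i N P)
structL-renN g inj i N (mu M)     =
  cong mu (trans (structL-renN (ext g) (ext-injective inj) (suc i) (renN suc N) M)
    (cong (λ N' → structL (suc (g i)) N' (renN (ext g) M)) (renN-suc-comm g N)))

erase-renN : ∀ g h → Injective _≡_ _≡_ g → ∀ i →
             (∀ j → ¬ (j ≡ i) → punch (g i) (g j) ≡ h (punch i j)) →
             ∀ M → erase (g i) (renN g M) ≡ renN h (erase i M)
erase-renN g h inj i gh (var x)    = refl
erase-renN g h inj i gh (lam M)    = cong lam (erase-renN g h inj i gh M)
erase-renN g h inj i gh (app M N)  = cong₂ app (erase-renN g h inj i gh M) (erase-renN g h inj i gh N)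
erase-renN g h inj i gh (name j P) rewrite ≡ᵇ-injective inj j i with j ≡ᵇ i in e
... | true  = erase-renN g h inj i gh P
... | false = cong₂ name (gh j (≡ᵇ-false⇒≢ j i e)) (erase-renN g h inj i gh P)
erase-renN g h inj i gh (mu M)     = cong mu (erase-renN (ext g) (ext h) (ext-injective inj) (suc i) gh' M)
  where
  gh' : ∀ j → ¬ (j ≡ suc i) → punch (suc (g i)) (ext g j) ≡ ext h (punch (suc i) j)
  gh' zero    _   = refl
  gh' (suc j) j≢i = begin
    punch (suc (g i)) (suc (g j)) ≡⟨ punch-suc (g i) (g j) (j≢i ∘ cong suc ∘ inj) ⟩
    suc (punch (g i) (g j))       ≡⟨ cong suc (gh j (j≢i ∘ cong suc)) ⟩
    suc (h (punch i j))           ≡⟨ cong (ext h) (punch-suc i j (j≢i ∘ cong suc)) ⟨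
    ext h (punch (suc i) (suc j)) ∎
    where open ≡-Reasoning

renT-⟶ : ∀ f {M M'} → M ⟶ M' → renT f M ⟶ renT f M'
renT-⟶ f (r-β {M} {N}) = subst (app (lam (renT (ext f) M)) (renT f N) ⟶_) (sym renT-β) r-β
  where
  single-ext : renT f ∘ single N ≗ single (renT f N) ∘ ext f
  single-ext zero    = refl
  single-ext (suc k) = refl
  renT-β : renT f (subT (single N) M) ≡ subT (single (renT f N)) (renT (ext f) M)
  renT-β = trans (renT-subT f (single N) M)
    (trans (subT-cong single-ext M) (sym (subT-renT (single (renT f N)) (ext f) M)))
renT-⟶ f (r-μ {M} {N}) = subst (app (mu (renT f M)) (renT f N) ⟶_) (cong mu (sym renT-μ)) r-μ
  where
  renT-μ : renT f (structR 0 (renN suc N) M) ≡ structR 0 (renN suc (renT f N)) (renT f M)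
  renT-μ = trans (structR-renT f 0 (renN suc N) M)
    (cong (λ N' → structR 0 N' (renT f M)) (renT-renN f suc N))
renT-⟶ f (r-μ' {M} {N}) = subst (app (renT f N) (mu (renT f M)) ⟶_) (cong mu (sym renT-μ')) r-μ'
  where
  renT-μ' : renT f (structL 0 (renN suc N) M) ≡ structL 0 (renN suc (renT f N)) (renT f M)
  renT-μ' = trans (structL-renT f 0 (renN suc N) M)
    (cong (λ N' → structL 0 N' (renT f M)) (renT-renN f suc N))
renT-⟶ f (r-ρ {β} {M}) = subst (name β (mu (renT f M)) ⟶_) (sym (renT-renN f (singleN β) M)) r-ρ
renT-⟶ f (r-ε {M})     = subst (mu (mu (renT f M)) ⟶_) (cong mu (sym (erase-renT f 0 M))) r-ε
renT-⟶ f (c-lam s)  = c-lam (renT-⟶ (ext f) s)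
renT-⟶ f (c-appl s) = c-appl (renT-⟶ f s)
renT-⟶ f (c-appr s) = c-appr (renT-⟶ f s)
renT-⟶ f (c-name s) = c-name (renT-⟶ f s)
renT-⟶ f (c-mu s)   = c-mu (renT-⟶ f s)

renN-⟶ : ∀ g → Injective _≡_ _≡_ g → ∀ {M M'} → M ⟶ M' → renN g M ⟶ renN g M'
renN-⟶ g inj (r-β {M} {N}) = subst (app (lam (renN g M)) (renN g N) ⟶_) (sym renN-β) r-β
  where
  single-renN : renN g ∘ single N ≗ single (renN g N)
  single-renN zero    = refl
  single-renN (suc k) = refl
  renN-β : renN g (subT (single N) M) ≡ subT (single (renN g N)) (renN g M)
  renN-β = trans (renN-subT g (single N) M) (subT-cong single-renN (renN g M))
renN-⟶ g inj (r-μ {M} {N}) =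
  subst (app (mu (renN (ext g) M)) (renN g N) ⟶_) (cong mu (sym renN-μ)) r-μ
  where
  renN-μ : renN (ext g) (structR 0 (renN suc N) M) ≡ structR 0 (renN suc (renN g N)) (renN (ext g) M)
  renN-μ = trans (structR-renN (ext g) (ext-injective inj) 0 (renN suc N) M)
    (cong (λ N' → structR 0 N' (renN (ext g) M)) (renN-suc-comm g N))
renN-⟶ g inj (r-μ' {M} {N}) =
  subst (app (renN g N) (mu (renN (ext g) M)) ⟶_) (cong mu (sym renN-μ')) r-μ'
  where
  renN-μ' : renN (ext g) (structL 0 (renN suc N) M) ≡ structL 0 (renN suc (renN g N)) (renN (ext g) M)
  renN-μ' = trans (structL-renN (ext g) (ext-injective inj) 0 (renN suc N) M)
    (cong (λ N' → structL 0 N' (renN (ext g) M)) (renN-suc-comm g N))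
renN-⟶ g inj (r-ρ {β} {M}) = subst (name (g β) (mu (renN (ext g) M)) ⟶_) (sym renN-ρ) r-ρ
  where
  singleN-ext : g ∘ singleN β ≗ singleN (g β) ∘ ext g
  singleN-ext zero    = refl
  singleN-ext (suc k) = refl
  renN-ρ : renN g (renN (singleN β) M) ≡ renN (singleN (g β)) (renN (ext g) M)
  renN-ρ = trans (renN-∘ g (singleN β) M)
    (trans (renN-cong singleN-ext M) (sym (renN-∘ (singleN (g β)) (ext g) M)))
renN-⟶ g inj (r-ε {M}) = subst (mu (mu (renN (ext (ext g)) M)) ⟶_) (cong mu renN-ε) r-ε
  where
  punch-ext : ∀ j → ¬ (j ≡ 0) → punch 0 (ext (ext g) j) ≡ ext g (punch 0 j)
  punch-ext zero    j≢0 = ⊥-elim (j≢0 refl)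
  punch-ext (suc j) _   = refl
  renN-ε : erase 0 (renN (ext (ext g)) M) ≡ renN (ext g) (erase 0 M)
  renN-ε = erase-renN (ext (ext g)) (ext g) (ext-injective (ext-injective inj)) 0 punch-ext M
renN-⟶ g inj (c-lam s)  = c-lam (renN-⟶ g inj s)
renN-⟶ g inj (c-appl s) = c-appl (renN-⟶ g inj s)
renN-⟶ g inj (c-appr s) = c-appr (renN-⟶ g inj s)
renN-⟶ g inj (c-name s) = c-name (renN-⟶ g inj s)
renN-⟶ g inj (c-mu s)   = c-mu (renN-⟶ (ext g) (ext-injective inj) s)

-- Normal forms

NotMu : Tm → Set
NotMu (mu _) = ⊥
NotMu _      = ⊤

NotAbs : Tm → Set
NotAbs (lam _) = ⊥
NotAbs (mu _)  = ⊥
NotAbs _       = ⊤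

Neutral : Tm → Set
Neutral (var _)   = ⊤
Neutral (app _ _) = ⊤
Neutral _         = ⊥

data MuView : Tm → Set where
  is-mu  : ∀ L → MuView (mu L)
  not-mu : ∀ {N} → NotMu N → MuView N

mu-view : ∀ N → MuView N
mu-view (var x)    = not-mu tt
mu-view (lam N)    = not-mu tt
mu-view (app N P)  = not-mu tt
mu-view (name α N) = not-mu tt
mu-view (mu L)     = is-mu L

Neutral⇒NotAbs : ∀ M → Neutral M → NotAbs M
Neutral⇒NotAbs (var x)   _ = tt
Neutral⇒NotAbs (app _ _) _ = tt

data NF : Tm → Set where
  nvar  : ∀ {x} → NF (var x)
  nlam  : ∀ {M} → NF M → NF (lam M)
  napp  : ∀ {M N} → NF M → NF N → NotAbs M → NotMu N → NF (app M N)
  nname : ∀ {α M} → NF M → NotMu M → NF (name α M)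
  nmu   : ∀ {M} → NF M → NotMu M → NF (mu M)

NF⇒Normal : ∀ {M} → NF M → Normal M
NF⇒Normal (nlam n)         _ (c-lam s)  = NF⇒Normal n _ s
NF⇒Normal (napp n m () _)  _ r-β
NF⇒Normal (napp n m () _)  _ r-μ
NF⇒Normal (napp n m _ ())  _ r-μ'
NF⇒Normal (napp n m _ _)   _ (c-appl s) = NF⇒Normal n _ s
NF⇒Normal (napp n m _ _)   _ (c-appr s) = NF⇒Normal m _ s
NF⇒Normal (nname n ())     _ r-ρ
NF⇒Normal (nname n _)      _ (c-name s) = NF⇒Normal n _ s
NF⇒Normal (nmu n ())       _ r-ε
NF⇒Normal (nmu n _)        _ (c-mu s)   = NF⇒Normal n _ s

Normal-app-head : ∀ M N → Normal (app M N) → NotAbs M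
Normal-app-head (var x)    N nMN = tt
Normal-app-head (lam M)    N nMN = nMN _ r-β
Normal-app-head (app M P)  N nMN = tt
Normal-app-head (name α P) N nMN = tt
Normal-app-head (mu M)     N nMN = nMN _ r-μ

Normal-app-arg : ∀ M N → Normal (app M N) → NotMu N
Normal-app-arg M N nMN with mu-view N
... | not-mu ¬μ = ¬μ
... | is-mu L   = nMN _ r-μ'

Normal-name-body : ∀ α M → Normal (name α M) → NotMu M
Normal-name-body α M nM with mu-view M
... | not-mu ¬μ = ¬μ
... | is-mu L   = nM _ r-ρ

Normal-mu-body : ∀ M → Normal (mu M) → NotMu M
Normal-mu-body M nM with mu-view M
... | not-mu ¬μ = ¬μ
... | is-mu L   = nM _ r-ε

Normal⇒NF : ∀ M → Normal M → NF M
Normal⇒NF (var x)    nM = nvar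
Normal⇒NF (lam M)    nM = nlam (Normal⇒NF M (λ _ → nM _ ∘ c-lam))
Normal⇒NF (app M N)  nM = napp (Normal⇒NF M (λ _ → nM _ ∘ c-appl)) (Normal⇒NF N (λ _ → nM _ ∘ c-appr))
                               (Normal-app-head M N nM) (Normal-app-arg M N nM)
Normal⇒NF (name α M) nM = nname (Normal⇒NF M (λ _ → nM _ ∘ c-name)) (Normal-name-body α M nM)
Normal⇒NF (mu M)     nM = nmu (Normal⇒NF M (λ _ → nM _ ∘ c-mu)) (Normal-mu-body M nM)

NotMu-renT : ∀ f M → NotMu M → NotMu (renT f M)
NotMu-renT f (var x)    _ = tt
NotMu-renT f (lam M)    _ = tt
NotMu-renT f (app M N)  _ = tt
NotMu-renT f (name α M) _ = tt

NotMu-renN : ∀ g M → NotMu M → NotMu (renN g M)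
NotMu-renN g (var x)    _ = tt
NotMu-renN g (lam M)    _ = tt
NotMu-renN g (app M N)  _ = tt
NotMu-renN g (name α M) _ = tt

NotAbs-renT : ∀ f M → NotAbs M → NotAbs (renT f M)
NotAbs-renT f (var x)    _ = tt
NotAbs-renT f (app M N)  _ = tt
NotAbs-renT f (name α M) _ = tt

NotAbs-renN : ∀ g M → NotAbs M → NotAbs (renN g M)
NotAbs-renN g (var x)    _ = tt
NotAbs-renN g (app M N)  _ = tt
NotAbs-renN g (name α M) _ = tt

Neutral-renT : ∀ f M → Neutral M → Neutral (renT f M)
Neutral-renT f (var x)   _ = tt
Neutral-renT f (app M N) _ = tt

Neutral-renN : ∀ g M → Neutral M → Neutral (renN g M)
Neutral-renN g (var x)   _ = tt
Neutral-renN g (app M N) _ = tt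

NF-renT : ∀ f {M} → NF M → NF (renT f M)
NF-renT f nvar                     = nvar
NF-renT f (nlam n)                 = nlam (NF-renT (ext f) n)
NF-renT f (napp {M} {N} n m ¬a ¬μ) =
  napp (NF-renT f n) (NF-renT f m) (NotAbs-renT f M ¬a) (NotMu-renT f N ¬μ)
NF-renT f (nname {M = M} n ¬μ)     = nname (NF-renT f n) (NotMu-renT f M ¬μ)
NF-renT f (nmu {M} n ¬μ)           = nmu (NF-renT f n) (NotMu-renT f M ¬μ)

NF-renN : ∀ g {M} → NF M → NF (renN g M)
NF-renN g nvar                     = nvar
NF-renN g (nlam n)                 = nlam (NF-renN g n)
NF-renN g (napp {M} {N} n m ¬a ¬μ) =
  napp (NF-renN g n) (NF-renN g m) (NotAbs-renN g M ¬a) (NotMu-renN g N ¬μ)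
NF-renN g (nname {M = M} n ¬μ)     = nname (NF-renN g n) (NotMu-renN g M ¬μ)
NF-renN g (nmu {M} n ¬μ)           = nmu (NF-renN (ext g) n) (NotMu-renN (ext g) M ¬μ)

-- Typing

_∶_⊆_ : (ℕ → ℕ) → List Ty → List Ty → Set
f ∶ Γ ⊆ Δ = ∀ x {B} → Γ ‼ x ≡ just B → Δ ‼ f x ≡ just B

ext-⊆ : ∀ {f Γ Δ} A → f ∶ Γ ⊆ Δ → ext f ∶ (A ∷ Γ) ⊆ (A ∷ Δ)
ext-⊆ A f⊆ zero    e = e
ext-⊆ A f⊆ (suc x) e = f⊆ x e

suc-⊆ : ∀ Γ A → suc ∶ Γ ⊆ (A ∷ Γ)
suc-⊆ Γ A x e = e

⊢-renT : ∀ {Γ Δ Θ M A} f → f ∶ Γ ⊆ Δ → Γ ⊢ M ∶ A ∣ Θ → Δ ⊢ renT f M ∶ A ∣ Θ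
⊢-renT f f⊆ (ty-var e)            = ty-var (f⊆ _ e)
⊢-renT f f⊆ (ty-lam {A = A} d)    = ty-lam (⊢-renT (ext f) (ext-⊆ A f⊆) d)
⊢-renT f f⊆ (ty-app d d')         = ty-app (⊢-renT f f⊆ d) (⊢-renT f f⊆ d')
⊢-renT f f⊆ (ty-name e d)         = ty-name e (⊢-renT f f⊆ d)
⊢-renT f f⊆ (ty-mu d)             = ty-mu (⊢-renT f f⊆ d)

⊢-renN : ∀ {Γ Θ Θ' M A} g → g ∶ Θ ⊆ Θ' → Γ ⊢ M ∶ A ∣ Θ → Γ ⊢ renN g M ∶ A ∣ Θ'
⊢-renN g g⊆ (ty-var e)            = ty-var e
⊢-renN g g⊆ (ty-lam d)            = ty-lam (⊢-renN g g⊆ d)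
⊢-renN g g⊆ (ty-app d d')         = ty-app (⊢-renN g g⊆ d) (⊢-renN g g⊆ d')
⊢-renN g g⊆ (ty-name e d)         = ty-name (g⊆ _ e) (⊢-renN g g⊆ d)
⊢-renN g g⊆ (ty-mu {A = A} d)     = ty-mu (⊢-renN (ext g) (ext-⊆ A g⊆) d)

⊢-subT : ∀ {Γ Δ Θ M A} σ → (∀ x {B} → Γ ‼ x ≡ just B → Δ ⊢ σ x ∶ B ∣ Θ) →
         Γ ⊢ M ∶ A ∣ Θ → Δ ⊢ subT σ M ∶ A ∣ Θ
⊢-subT σ ⊢σ (ty-var e)    = ⊢σ _ e
⊢-subT {Γ} {Δ} {Θ} σ ⊢σ (ty-lam {A = A} d) = ty-lam (⊢-subT (extsT σ) ⊢extsT d)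
  where
  ⊢extsT : ∀ x {B} → (A ∷ Γ) ‼ x ≡ just B → (A ∷ Δ) ⊢ extsT σ x ∶ B ∣ Θ
  ⊢extsT zero    e = ty-var e
  ⊢extsT (suc x) e = ⊢-renT suc (suc-⊆ Δ A) (⊢σ x e)
⊢-subT σ ⊢σ (ty-app d d') = ty-app (⊢-subT σ ⊢σ d) (⊢-subT σ ⊢σ d')
⊢-subT σ ⊢σ (ty-name e d) = ty-name e (⊢-subT σ ⊢σ d)
⊢-subT {Θ = Θ} σ ⊢σ (ty-mu {A = A} d) =
  ty-mu (⊢-subT (renN suc ∘ σ) (λ x e → ⊢-renN suc (suc-⊆ Θ A) (⊢σ x e)) d)

_≡_except_ : List Ty → List Ty → ℕ → Set
Θ ≡ Θ' except i = ∀ j → ¬ (j ≡ i) → Θ ‼ j ≡ Θ' ‼ j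

∷-except : ∀ {Θ Θ' i} D → Θ ≡ Θ' except i → (D ∷ Θ) ≡ (D ∷ Θ') except suc i
∷-except D Θ≡Θ' zero    _   = refl
∷-except D Θ≡Θ' (suc j) j≢i = Θ≡Θ' j (j≢i ∘ cong suc)

except-head : ∀ {X Y} Θ → (X ∷ Θ) ≡ (Y ∷ Θ) except 0
except-head Θ zero    j≢0 = ⊥-elim (j≢0 refl)
except-head Θ (suc j) _   = refl

⊢-structR : ∀ {Γ Θ Θ' M A B C} i N → Θ ‼ i ≡ just (B ⇒ C) → Θ' ‼ i ≡ just C →
            Θ ≡ Θ' except i → Γ ⊢ N ∶ B ∣ Θ' →
            Γ ⊢ M ∶ A ∣ Θ → Γ ⊢ structR i N M ∶ A ∣ Θ'
⊢-structR i N Θi Θ'i Θ≡Θ' ⊢N (ty-var e)   = ty-var e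
⊢-structR {Γ} i N Θi Θ'i Θ≡Θ' ⊢N (ty-lam {A = A} d) =
  ty-lam (⊢-structR i (renT suc N) Θi Θ'i Θ≡Θ' (⊢-renT suc (suc-⊆ Γ A) ⊢N) d)
⊢-structR i N Θi Θ'i Θ≡Θ' ⊢N (ty-app d d') =
  ty-app (⊢-structR i N Θi Θ'i Θ≡Θ' ⊢N d) (⊢-structR i N Θi Θ'i Θ≡Θ' ⊢N d')
⊢-structR i N Θi Θ'i Θ≡Θ' ⊢N (ty-name {α = j} Θj d) with j ≡ᵇ i in eb
... | true with ≡ᵇ-true⇒≡ j i eb
...   | refl with trans (sym Θj) Θi
...     | refl = ty-name Θ'i (ty-app (⊢-structR i N Θi Θ'i Θ≡Θ' ⊢N d) ⊢N)
⊢-structR i N Θi Θ'i Θ≡Θ' ⊢N (ty-name {α = j} Θj d) | false =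
  ty-name (trans (sym (Θ≡Θ' j (≡ᵇ-false⇒≢ j i eb))) Θj) (⊢-structR i N Θi Θ'i Θ≡Θ' ⊢N d)
⊢-structR {Θ' = Θ'} i N Θi Θ'i Θ≡Θ' ⊢N (ty-mu {A = D} d) =
  ty-mu (⊢-structR (suc i) (renN suc N) Θi Θ'i (∷-except D Θ≡Θ') (⊢-renN suc (suc-⊆ Θ' D) ⊢N) d)

⊢-structL : ∀ {Γ Θ Θ' M A B C} i N → Θ ‼ i ≡ just B → Θ' ‼ i ≡ just C →
            Θ ≡ Θ' except i → Γ ⊢ N ∶ B ⇒ C ∣ Θ' →
            Γ ⊢ M ∶ A ∣ Θ → Γ ⊢ structL i N M ∶ A ∣ Θ'
⊢-structL i N Θi Θ'i Θ≡Θ' ⊢N (ty-var e)   = ty-var e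
⊢-structL {Γ} i N Θi Θ'i Θ≡Θ' ⊢N (ty-lam {A = A} d) =
  ty-lam (⊢-structL i (renT suc N) Θi Θ'i Θ≡Θ' (⊢-renT suc (suc-⊆ Γ A) ⊢N) d)
⊢-structL i N Θi Θ'i Θ≡Θ' ⊢N (ty-app d d') =
  ty-app (⊢-structL i N Θi Θ'i Θ≡Θ' ⊢N d) (⊢-structL i N Θi Θ'i Θ≡Θ' ⊢N d')
⊢-structL i N Θi Θ'i Θ≡Θ' ⊢N (ty-name {α = j} Θj d) with j ≡ᵇ i in eb
... | true with ≡ᵇ-true⇒≡ j i eb
...   | refl with trans (sym Θj) Θi
...     | refl = ty-name Θ'i (ty-app ⊢N (⊢-structL i N Θi Θ'i Θ≡Θ' ⊢N d))
⊢-structL i N Θi Θ'i Θ≡Θ' ⊢N (ty-name {α = j} Θj d) | false =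
  ty-name (trans (sym (Θ≡Θ' j (≡ᵇ-false⇒≢ j i eb))) Θj) (⊢-structL i N Θi Θ'i Θ≡Θ' ⊢N d)
⊢-structL {Θ' = Θ'} i N Θi Θ'i Θ≡Θ' ⊢N (ty-mu {A = D} d) =
  ty-mu (⊢-structL (suc i) (renN suc N) Θi Θ'i (∷-except D Θ≡Θ') (⊢-renN suc (suc-⊆ Θ' D) ⊢N) d)

⊢-erase : ∀ {Γ Θ Θ' M A} i → Θ ‼ i ≡ just bot →
          (∀ j → ¬ (j ≡ i) → Θ ‼ j ≡ Θ' ‼ punch i j) →
          Γ ⊢ M ∶ A ∣ Θ → Γ ⊢ erase i M ∶ A ∣ Θ'
⊢-erase i Θi Θ≡Θ' (ty-var e)    = ty-var e
⊢-erase i Θi Θ≡Θ' (ty-lam d)    = ty-lam (⊢-erase i Θi Θ≡Θ' d)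
⊢-erase i Θi Θ≡Θ' (ty-app d d') = ty-app (⊢-erase i Θi Θ≡Θ' d) (⊢-erase i Θi Θ≡Θ' d')
⊢-erase i Θi Θ≡Θ' (ty-name {α = j} Θj d) with j ≡ᵇ i in eb
... | true with ≡ᵇ-true⇒≡ j i eb
...   | refl with trans (sym Θj) Θi
...     | refl = ⊢-erase i Θi Θ≡Θ' d
⊢-erase i Θi Θ≡Θ' (ty-name {α = j} Θj d) | false =
  ty-name (trans (sym (Θ≡Θ' j (≡ᵇ-false⇒≢ j i eb))) Θj) (⊢-erase i Θi Θ≡Θ' d)
⊢-erase {Θ = Θ} {Θ'} i Θi Θ≡Θ' (ty-mu {A = D} d) = ty-mu (⊢-erase (suc i) Θi ∷-punch d)
  where
  ∷-punch : ∀ j → ¬ (j ≡ suc i) → (D ∷ Θ) ‼ j ≡ (D ∷ Θ') ‼ punch (suc i) j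
  ∷-punch zero    _   = refl
  ∷-punch (suc j) j≢i rewrite punch-suc i j (j≢i ∘ cong suc) = Θ≡Θ' j (j≢i ∘ cong suc)

subject-reduction : ∀ {Γ Θ M M' A} → M ⟶ M' → Γ ⊢ M ∶ A ∣ Θ → Γ ⊢ M' ∶ A ∣ Θ
subject-reduction {Γ} {Θ} (r-β {M} {N}) (ty-app (ty-lam {A = A} d) ⊢N) = ⊢-subT (single N) ⊢single d
  where
  ⊢single : ∀ x {B} → (A ∷ Γ) ‼ x ≡ just B → Γ ⊢ single N x ∶ B ∣ Θ
  ⊢single zero    e = subst (λ B → Γ ⊢ N ∶ B ∣ Θ) (just-injective e) ⊢N
  ⊢single (suc x) e = ty-var e
subject-reduction {Θ = Θ} {A = C} r-μ (ty-app (ty-mu d) ⊢N) =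
  ty-mu (⊢-structR 0 _ refl refl (except-head Θ) (⊢-renN suc (suc-⊆ Θ C) ⊢N) d)
subject-reduction {Θ = Θ} {A = C} r-μ' (ty-app ⊢N (ty-mu d)) =
  ty-mu (⊢-structL 0 _ refl refl (except-head Θ) (⊢-renN suc (suc-⊆ Θ C) ⊢N) d)
subject-reduction {Θ = Θ} (r-ρ {β}) (ty-name {A = A} Θβ (ty-mu d)) = ⊢-renN (singleN β) singleN-⊆ d
  where
  singleN-⊆ : singleN β ∶ (A ∷ Θ) ⊆ Θ
  singleN-⊆ zero    e = trans Θβ e
  singleN-⊆ (suc x) e = e
subject-reduction {Θ = Θ} r-ε (ty-mu {A = A} (ty-mu d)) = ty-mu (⊢-erase 0 refl punch-0 d)
  where
  punch-0 : ∀ j → ¬ (j ≡ 0) → (bot ∷ A ∷ Θ) ‼ j ≡ (A ∷ Θ) ‼ punch 0 j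
  punch-0 zero    j≢0 = ⊥-elim (j≢0 refl)
  punch-0 (suc j) _   = refl
subject-reduction (c-lam s)  (ty-lam d)    = ty-lam (subject-reduction s d)
subject-reduction (c-appl s) (ty-app d d') = ty-app (subject-reduction s d) d'
subject-reduction (c-appr s) (ty-app d d') = ty-app d (subject-reduction s d')
subject-reduction (c-name s) (ty-name e d) = ty-name e (subject-reduction s d)
subject-reduction (c-mu s)   (ty-mu d)     = ty-mu (subject-reduction s d)

Typable-⟶* : ∀ {M M'} → M ⟶* M' → Typable M → Typable M'
Typable-⟶* ε        ⊢M              = ⊢M
Typable-⟶* (s ◅ ss) (Γ , Θ , A , d) = Typable-⟶* ss (Γ , Θ , A , subject-reduction s d)

NotAbs-arrow⇒Neutral : ∀ {Γ Θ Q B C} → NotAbs Q → Γ ⊢ Q ∶ B ⇒ C ∣ Θ → Neutral Q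
NotAbs-arrow⇒Neutral {Q = var x}   _ _ = tt
NotAbs-arrow⇒Neutral {Q = app _ _} _ _ = tt

Neutral-erase : ∀ i Q → Neutral Q → Neutral (erase i Q)
Neutral-erase i (var x)   _ = tt
Neutral-erase i (app _ _) _ = tt

-- Erasing [i] turns [i]P into P; typing guarantees that [i]P, of type ⊥, never heads an
-- application, so no redex is created.
NF-erase : ∀ {Γ Θ A} i K → NF K → Γ ⊢ K ∶ A ∣ Θ → NF (erase i K) × (NotMu K → NotMu (erase i K))
NF-erase i (var x)    nvar              _              = nvar , λ _ → tt
NF-erase i (lam M)    (nlam n)          (ty-lam d)     = nlam (proj₁ (NF-erase i M n d)) , λ _ → tt
NF-erase i (app Q R)  (napp n m ¬a ¬μ)  (ty-app dQ dR) =
  napp (proj₁ (NF-erase i Q n dQ)) (proj₁ (NF-erase i R m dR))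
       (Neutral⇒NotAbs _ (Neutral-erase i Q (NotAbs-arrow⇒Neutral ¬a dQ))) (proj₂ (NF-erase i R m dR) ¬μ) ,
  λ _ → tt
NF-erase i (name j P) (nname n ¬μ)      (ty-name _ d)  with j ≡ᵇ i
... | true  = proj₁ (NF-erase i P n d) , λ _ → proj₂ (NF-erase i P n d) ¬μ
... | false = nname (proj₁ (NF-erase i P n d)) (proj₂ (NF-erase i P n d) ¬μ) , λ _ → tt
NF-erase i (mu M)     (nmu n ¬μ)        (ty-mu d)      =
  nmu (proj₁ (NF-erase (suc i) M n d)) (proj₂ (NF-erase (suc i) M n d) ¬μ) , λ ()

NotMu-structL : ∀ i N M → NotMu M → NotMu (structL i N M)
NotMu-structL i N (var x)    _ = tt
NotMu-structL i N (lam M)    _ = tt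
NotMu-structL i N (app M P)  _ = tt
NotMu-structL i N (name j P) _ with j ≡ᵇ i
... | true  = tt
... | false = tt

NotAbs-structL : ∀ i N M → NotAbs M → NotAbs (structL i N M)
NotAbs-structL i N (var x)    _ = tt
NotAbs-structL i N (app M P)  _ = tt
NotAbs-structL i N (name j P) _ with j ≡ᵇ i
... | true  = tt
... | false = tt

Neutral-structL : ∀ i N M → Neutral M → Neutral (structL i N M)
Neutral-structL i N (var x)   _ = tt
Neutral-structL i N (app M P) _ = tt

NF-structL : ∀ i H L → NF H → Neutral H → NF L → NF (structL i H L)
NF-structL i H (var x)    nH vH nvar             = nvar
NF-structL i H (lam M)    nH vH (nlam n)         =
  nlam (NF-structL i (renT suc H) M (NF-renT suc nH) (Neutral-renT suc H vH) n)
NF-structL i H (app M N)  nH vH (napp n m ¬a ¬μ) =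
  napp (NF-structL i H M nH vH n) (NF-structL i H N nH vH m) (NotAbs-structL i H M ¬a) (NotMu-structL i H N ¬μ)
NF-structL i H (name j P) nH vH (nname n ¬μ)     with j ≡ᵇ i
... | true  = nname (napp nH (NF-structL i H P nH vH n) (Neutral⇒NotAbs H vH) (NotMu-structL i H P ¬μ)) tt
... | false = nname (NF-structL i H P nH vH n) (NotMu-structL i H P ¬μ)
NF-structL i H (mu M)     nH vH (nmu n ¬μ)       =
  nmu (NF-structL (suc i) (renN suc H) M (NF-renN suc nH) (Neutral-renN suc H vH) n)
      (NotMu-structL (suc i) (renN suc H) M ¬μ)

-- Pushing arguments into a normal μ-abstraction

-- NeutralAt i M: every [i]P in M (i shifted under μ-binders) has P neutral.  This is what makes
-- [i](P)N, the result of M[i :=_r N], free of β- and μ-redexes.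
NeutralAt : ℕ → Tm → Set
NeutralAt i (var x)    = ⊤
NeutralAt i (lam M)    = NeutralAt i M
NeutralAt i (app M N)  = NeutralAt i M × NeutralAt i N
NeutralAt i (name j P) = (j ≡ i → Neutral P) × NeutralAt i P
NeutralAt i (mu M)     = NeutralAt (suc i) M

NeutralAt-renT : ∀ f i M → NeutralAt i M → NeutralAt i (renT f M)
NeutralAt-renT f i (var x)    _       = tt
NeutralAt-renT f i (lam M)    a       = NeutralAt-renT (ext f) i M a
NeutralAt-renT f i (app M N)  (a , b) = NeutralAt-renT f i M a , NeutralAt-renT f i N b
NeutralAt-renT f i (name j P) (a , b) = Neutral-renT f P ∘ a , NeutralAt-renT f i P b
NeutralAt-renT f i (mu M)     a       = NeutralAt-renT f (suc i) M a

NeutralAt-renN : ∀ g i M → (∀ j → g j ≡ i → NeutralAt j M) → NeutralAt i (renN g M)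
NeutralAt-renN g i (var x)    a = tt
NeutralAt-renN g i (lam M)    a = NeutralAt-renN g i M a
NeutralAt-renN g i (app M N)  a =
  NeutralAt-renN g i M (λ j e → proj₁ (a j e)) , NeutralAt-renN g i N (λ j e → proj₂ (a j e))
NeutralAt-renN g i (name k P) a =
  (λ e → Neutral-renN g P (proj₁ (a k e) refl)) , NeutralAt-renN g i P (λ j e → proj₂ (a j e))
NeutralAt-renN g i (mu M)     a = NeutralAt-renN (ext g) (suc i) M a'
  where
  a' : ∀ j → ext g j ≡ suc i → NeutralAt j M
  a' (suc j) e = a j (suc-injective e)

NeutralAt-fresh : ∀ M → NeutralAt 0 (renN suc M)
NeutralAt-fresh M = NeutralAt-renN suc 0 M (λ _ ())

NeutralAt-shift : ∀ i M → NeutralAt i M → NeutralAt (suc i) (renN suc M)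
NeutralAt-shift i M a =
  NeutralAt-renN suc (suc i) M (λ j e → subst (λ k → NeutralAt k M) (sym (suc-injective e)) a)

NeutralAt-structL-self : ∀ i H L → NeutralAt i H → NeutralAt i (structL i H L)
NeutralAt-structL-self i H (var x)    a = tt
NeutralAt-structL-self i H (lam M)    a = NeutralAt-structL-self i (renT suc H) M (NeutralAt-renT suc i H a)
NeutralAt-structL-self i H (app M N)  a = NeutralAt-structL-self i H M a , NeutralAt-structL-self i H N a
NeutralAt-structL-self i H (name j P) a with j ≡ᵇ i in e
... | true  = (λ _ → tt) , (a , NeutralAt-structL-self i H P a)
... | false = (λ j≡i → ⊥-elim (≡ᵇ-false⇒≢ j i e j≡i)) , NeutralAt-structL-self i H P a
NeutralAt-structL-self i H (mu M)     a = NeutralAt-structL-self (suc i) (renN suc H) M (NeutralAt-shift i H a)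

NeutralAt-structL : ∀ i k H L → NeutralAt k H → NeutralAt k L → NeutralAt k (structL i H L)
NeutralAt-structL i k H (var x)    a b       = tt
NeutralAt-structL i k H (lam M)    a b       =
  NeutralAt-structL i k (renT suc H) M (NeutralAt-renT suc k H a) b
NeutralAt-structL i k H (app M N)  a (b , c) = NeutralAt-structL i k H M a b , NeutralAt-structL i k H N a c
NeutralAt-structL i k H (name j P) a (b , c) with j ≡ᵇ i
... | true  = (λ _ → tt) , (a , NeutralAt-structL i k H P a c)
... | false = Neutral-structL i H P ∘ b , NeutralAt-structL i k H P a c
NeutralAt-structL i k H (mu M)     a b       =
  NeutralAt-structL (suc i) (suc k) (renN suc H) M (NeutralAt-shift k H a) b

NormalisesAt : ℕ → Tm → Tm → Set
NormalisesAt i K X =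
  Σ Tm λ K' → (X ⟶* K') × NF K' × NeutralAt i K' × (NotMu K → NotMu K') × (Neutral K → Neutral K')

name-app-normalises : ∀ i N P → NF P → Neutral P → NeutralAt i P → NF N → NeutralAt i N →
  Σ Tm λ K → (name i (app P N) ⟶* K) × NF K × NeutralAt i K × NotMu K
name-app-normalises i N P nP vP aP nN aN with mu-view N
... | not-mu ¬μN = _ , ε , nname (napp nP nN (Neutral⇒NotAbs P vP) ¬μN) tt , ((λ _ → tt) , (aP , aN)) , tt
... | is-mu L with nN
...   | nmu nL ¬μ =
  renN (singleN i) L' ,
  (c-name r-μ' ◅ r-ρ ◅ ε) ,
  NF-renN (singleN i) (NF-structL 0 (renN suc P) L (NF-renN suc nP) (Neutral-renN suc P vP) nL) ,
  NeutralAt-renN (singleN i) i L' aL' ,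
  NotMu-renN (singleN i) L' (NotMu-structL 0 (renN suc P) L ¬μ)
  where
  L' : Tm
  L' = structL 0 (renN suc P) L
  aL' : ∀ j → singleN i j ≡ i → NeutralAt j L'
  aL' zero    _    = NeutralAt-structL-self 0 (renN suc P) L (NeutralAt-fresh P)
  aL' (suc j) refl = NeutralAt-structL 0 (suc j) (renN suc P) L (NeutralAt-shift j P aP) aN

structR-normalises : ∀ {Γ Θ A} i N K → NF K → Γ ⊢ K ∶ A ∣ Θ → NeutralAt i K → NF N → NeutralAt i N →
                     NormalisesAt i K (structR i N K)
structR-normalises i N (var x) nvar _ _ _ _ = var x , ε , nvar , tt , (λ _ → tt) , (λ _ → tt)
structR-normalises i N (lam M) (nlam n) (ty-lam d) a nN aN
  with structR-normalises i (renT suc N) M n d a (NF-renT suc nN) (NeutralAt-renT suc i N aN)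
... | M' , r , n' , a' , _ , _ = lam M' , gmap lam c-lam r , nlam n' , a' , (λ _ → tt) , (λ ())
structR-normalises i N (app Q R) (napp nQ nR ¬a ¬μ) (ty-app dQ dR) (aQ , aR) nN aN
  with structR-normalises i N Q nQ dQ aQ nN aN | structR-normalises i N R nR dR aR nN aN
... | Q' , rQ , nQ' , aQ' , _ , vQ | R' , rR , nR' , aR' , ¬μR , _ =
  app Q' R' ,
  (gmap (λ Q'' → app Q'' (structR i N R)) c-appl rQ ◅◅ gmap (app Q') c-appr rR) ,
  napp nQ' nR' (Neutral⇒NotAbs Q' (vQ (NotAbs-arrow⇒Neutral ¬a dQ))) (¬μR ¬μ) , (aQ' , aR') ,
  (λ _ → tt) , (λ _ → tt)
structR-normalises i N (name j P) (nname n ¬μ) (ty-name _ d) (aj , aP) nN aN with j ≡ᵇ i in eb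
... | true with ≡ᵇ-true⇒≡ j i eb
...   | refl with structR-normalises i N P n d aP nN aN
...     | P' , r , n' , a' , _ , vP with name-app-normalises i N P' n' (vP (aj refl)) a' nN aN
...       | K , r' , nK , aK , ¬μK =
  K , (gmap (λ P'' → name i (app P'' N)) (c-name ∘ c-appl) r ◅◅ r') , nK , aK , (λ _ → ¬μK) , (λ ())
structR-normalises i N (name j P) (nname n ¬μ) (ty-name _ d) (aj , aP) nN aN | false
  with structR-normalises i N P n d aP nN aN
... | P' , r , n' , a' , ¬μP , _ =
  name j P' , gmap (name j) c-name r , nname n' (¬μP ¬μ) , (⊥-elim ∘ ≡ᵇ-false⇒≢ j i eb , a') ,
  (λ _ → tt) , (λ ())
structR-normalises i N (mu M) (nmu n ¬μ) (ty-mu d) a nN aN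
  with structR-normalises (suc i) (renN suc N) M n d a (NF-renN suc nN) (NeutralAt-shift i N aN)
... | M' , r , n' , a' , ¬μM , _ = mu M' , gmap mu c-mu r , nmu n' (¬μM ¬μ) , a' , (λ ()) , (λ ())

-- Weak normalisation

WN-expand : ∀ {M M'} → M ⟶* M' → WN M' → WN M
WN-expand r (N , r' , n) = N , r ◅◅ r' , n

apps-⟶ : ∀ {M M'} Ns → M ⟶ M' → apps M Ns ⟶ apps M' Ns
apps-⟶ []       s = s
apps-⟶ (N ∷ Ns) s = apps-⟶ Ns (c-appl s)

apps-⟶* : ∀ {M M'} Ns → M ⟶* M' → apps M Ns ⟶* apps M' Ns
apps-⟶* Ns = gmap (λ M → apps M Ns) (apps-⟶ Ns)

apps-mu-⟶* : ∀ M Ns → apps (mu M) Ns ⟶* mu (muStructRs M Ns)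
apps-mu-⟶* M []       = ε
apps-mu-⟶* M (N ∷ Ns) = apps-⟶ Ns r-μ ◅ apps-mu-⟶* (structR 0 (renN suc N) M) Ns

Typable-apps-head : ∀ M Ns → Typable (apps M Ns) → Typable M
Typable-apps-head M []       ⊢M = ⊢M
Typable-apps-head M (N ∷ Ns) ⊢MNs with Typable-apps-head (app M N) Ns ⊢MNs
... | Γ , Θ , A , ty-app d _ = Γ , Θ , _ , d

WN-lam : ∀ x M → WN M → WN (lam (renT (bindAt x) M))
WN-lam x M (N , r , n) =
  lam (renT (bindAt x) N) ,
  gmap (lam ∘ renT (bindAt x)) (c-lam ∘ renT-⟶ (bindAt x)) r ,
  NF⇒Normal (nlam (NF-renT (bindAt x) (Normal⇒NF N n)))

Typable-lam : ∀ x M → Typable M → Typable (lam (renT (bindAt x) M))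
Typable-lam x M (Γ , Θ , A , d) = Γ , Θ , B ⇒ A , ty-lam (⊢-renT (bindAt x) bindAt-⊆ d)
  where
  -- if Γ does not type x then x does not occur in M, and any type will do
  B : Ty
  B = fromMaybe bot (Γ ‼ x)
  bindAt-⊆ : bindAt x ∶ Γ ⊆ (B ∷ Γ)
  bindAt-⊆ y {C} e with y ≡ᵇ x in eb
  ... | true  rewrite ≡ᵇ-true⇒≡ y x eb | e = refl
  ... | false = e

WN-mu-NF : ∀ T → NF T → Typable (mu T) → WN (mu T)
WN-mu-NF T nT ⊢μT with mu-view T
... | not-mu ¬μ = mu T , ε , NF⇒Normal (nmu nT ¬μ)
... | is-mu K with nT | ⊢μT
...   | nmu nK ¬μK | Γ , Θ , A , ty-mu (ty-mu d) =
  mu (erase 0 K) , r-ε ◅ ε , NF⇒Normal (nmu (proj₁ (NF-erase 0 K nK d)) (proj₂ (NF-erase 0 K nK d) ¬μK))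

WN-name-NF : ∀ α T → NF T → WN (name α T)
WN-name-NF α T nT with mu-view T
... | not-mu ¬μ = name α T , ε , NF⇒Normal (nname nT ¬μ)
... | is-mu K with nT
...   | nmu nK _ = renN (singleN α) K , r-ρ ◅ ε , NF⇒Normal (NF-renN (singleN α) nK)

WN-mu : ∀ α M → WN M → Typable (mu (renN (bindAt α) M)) → WN (mu (renN (bindAt α) M))
WN-mu α M (N , r , n) ⊢μM =
  WN-expand r' (WN-mu-NF (renN (bindAt α) N) (NF-renN (bindAt α) (Normal⇒NF N n)) (Typable-⟶* r' ⊢μM))
  where
  r' : mu (renN (bindAt α) M) ⟶* mu (renN (bindAt α) N)
  r' = gmap (mu ∘ renN (bindAt α)) (c-mu ∘ renN-⟶ (bindAt α) (bindAt-injective α)) r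

WN-name : ∀ α M → WN M → WN (name α M)
WN-name α M (N , r , n) = WN-expand (gmap (name α) c-name r) (WN-name-NF α N (Normal⇒NF N n))

data Head : Tm → Set where
  neutral : ∀ {T} → NF T → Neutral T → Head T
  μ-head  : ∀ {K} → NF (mu K) → NeutralAt 0 K → Head (mu K)

WN-apps-NF : ∀ Ns T → All NF Ns → Head T → Typable (apps T Ns) → WN (apps T Ns)
WN-apps-NF []       T []          (neutral nT _) _ = T , ε , NF⇒Normal nT
WN-apps-NF []       T []          (μ-head nT _)  _ = T , ε , NF⇒Normal nT
WN-apps-NF (N ∷ Ns) T (nN ∷ nNs) (neutral nT vT) ⊢TNs with mu-view N
... | not-mu ¬μN = WN-apps-NF Ns (app T N) nNs (neutral (napp nT nN (Neutral⇒NotAbs T vT) ¬μN) tt) ⊢TNs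
... | is-mu L with nN
...   | nmu nL ¬μL = WN-expand r (WN-apps-NF Ns (mu K) nNs head (Typable-⟶* r ⊢TNs))
  where
  K : Tm
  K = structL 0 (renN suc T) L
  r : apps (app T (mu L)) Ns ⟶* apps (mu K) Ns
  r = apps-⟶ Ns r-μ' ◅ ε
  head : Head (mu K)
  head = μ-head (nmu (NF-structL 0 (renN suc T) L (NF-renN suc nT) (Neutral-renN suc T vT) nL)
                     (NotMu-structL 0 (renN suc T) L ¬μL))
                (NeutralAt-structL-self 0 (renN suc T) L (NeutralAt-fresh T))
WN-apps-NF (N ∷ Ns) (mu K) (nN ∷ nNs) (μ-head (nmu nK ¬μK) aK) ⊢TNs
  with Typable-apps-head (app (mu K) N) Ns ⊢TNs
... | Γ , Θ , A , ty-app (ty-mu d) _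
  with structR-normalises 0 (renN suc N) K nK d aK (NF-renN suc nN) (NeutralAt-fresh N)
... | K' , rK , nK' , aK' , ¬μK' , _ =
  WN-expand r (WN-apps-NF Ns (mu K') nNs (μ-head (nmu nK' (¬μK' ¬μK)) aK') (Typable-⟶* r ⊢TNs))
  where
  r : apps (app (mu K) N) Ns ⟶* apps (mu K') Ns
  r = apps-⟶* Ns (r-μ ◅ gmap mu c-mu rK)

normalise-args : ∀ Ns → All WN Ns → Σ (List Tm) λ Ns' → All NF Ns' × (∀ M → apps M Ns ⟶* apps M Ns')
normalise-args []       []                   = [] , [] , λ _ → ε
normalise-args (N ∷ Ns) ((N' , rN , nN') ∷ wns) with normalise-args Ns wns
... | Ns' , nNs' , rNs = N' ∷ Ns' , Normal⇒NF N' nN' ∷ nNs' ,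
  λ M → rNs (app M N) ◅◅ apps-⟶* Ns' (gmap (app M) c-appr rN)

WN-var-apps : ∀ x Ns → All WN Ns → Typable (apps (var x) Ns) → WN (apps (var x) Ns)
WN-var-apps x Ns wns ⊢xNs with normalise-args Ns wns
... | Ns' , nNs' , rNs =
  WN-expand (rNs (var x)) (WN-apps-NF Ns' (var x) nNs' (neutral nvar tt) (Typable-⟶* (rNs (var x)) ⊢xNs))

theorem5p19 : Saturated (λ M → WN M × Typable M)
theorem5p19 = record
  { sub = λ _ → proj₂
  ; C1  = λ x M (wM , ⊢M) → WN-lam x M wM , Typable-lam x M ⊢M
  ; C2  = λ α M (wM , _) ⊢μM → WN-mu α M wM ⊢μM , ⊢μM
  ; C3  = λ α M (wM , _) ⊢αM → WN-name α M wM , ⊢αM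
  ; C4  = λ x Ns bNs ⊢xNs → WN-var-apps x Ns (All.map proj₁ bNs) ⊢xNs , ⊢xNs
  ; C5  = λ M N Ps _ _ _ _ ⊢redex (wM' , _) → WN-expand (apps-⟶ Ps r-β ◅ ε) wM' , ⊢redex
  ; C6  = λ M Ns _ _ ⊢redex (wM' , _) → WN-expand (apps-mu-⟶* M Ns) wM' , ⊢redex
  }
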